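{- There is no logical structure $(\mathscr{L},W)$ such that $W$ is an $r_1$-consequence operator.
   Context: A logical structure is a pair $(\mathscr{L},W)$ with $\mathscr{L}$ a set and $W:\mathcal{P}(\mathscr{L})\to\mathcal{P}(\mathscr{L})$. For a cardinal $\kappa$, $W$ is an $r_\kappa$-consequence operator if: (i) there is $\Gamma\subseteq\mathscr{L}$ with $\Gamma\not\subseteq W(\Gamma)$; (ii) there is $\Gamma\subseteq\mathscr{L}$ with $W(\Gamma)\not\subseteq\Gamma$; (iii) for all $\Gamma\subseteq\mathscr{L}$ with $|\Gamma|\ge\kappa$, $\Gamma\not\subseteq\mathscr{L}\setminus W(\Gamma)$; (iv) $\Gamma\subseteq\Sigma$ implies $W(\Gamma)\subseteq W(\Sigma)$. -}

module Defs where

open import Data.Bool using (Bool; true)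
open import Data.Product using (Σ; ∃; _×_)
open import Relation.Binary.PropositionalEquality using (_≡_)
open import Relation.Nullary using (¬_)

-- Subsets of 𝓛 (elements of the power set 𝒫(𝓛)) as characteristic functions,
-- i.e. the classical power set.
Subset : Set → Set
Subset 𝓛 = 𝓛 → Bool

_∈_ : {𝓛 : Set} → 𝓛 → Subset 𝓛 → Set
x ∈ Γ = Γ x ≡ true

_⊆_ : {𝓛 : Set} → Subset 𝓛 → Subset 𝓛 → Set
Γ ⊆ Δ = ∀ x → x ∈ Γ → x ∈ Δ

∁ : {𝓛 : Set} → Subset 𝓛 → Subset 𝓛
∁ Γ x with Γ x
... | true = Data.Bool.false
... | Data.Bool.false = true

CardAtLeast1 : {𝓛 : Set} → Subset 𝓛 → Set
CardAtLeast1 {𝓛} Γ = Σ 𝓛 (λ x → x ∈ Γ)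

-- A logical structure (𝓛 , W)
Operator : Set → Set
Operator 𝓛 = Subset 𝓛 → Subset 𝓛

IsR1ConsequenceOperator : {𝓛 : Set} → Operator 𝓛 → Set
IsR1ConsequenceOperator {𝓛} W =
    (∃ λ (Γ : Subset 𝓛) → ¬ (Γ ⊆ W Γ))
  × (∃ λ (Γ : Subset 𝓛) → ¬ (W Γ ⊆ Γ))
  × (∀ (Γ : Subset 𝓛) → CardAtLeast1 Γ → ¬ (Γ ⊆ ∁ (W Γ)))           -- (iii), κ = 1
  × (∀ (Γ Δ : Subset 𝓛) → Γ ⊆ Δ → W Γ ⊆ W Δ)

-- Monotonicity (iv) and (iii) for κ = 1 force W to be inflationary, contradicting (i):
-- if some x ∈ Γ lay outside W Γ, then Γ ∖ W Γ would be nonempty, while by monotonicity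
-- its image lies inside W Γ and so misses Γ ∖ W Γ entirely, against (iii).
module Submission where

open import Defs
open import Data.Bool using (true; false; not; _∧_)
open import Data.Bool.Properties using (¬-not; not-¬)
open import Data.Product using (_×_; _,_)
open import Relation.Binary.PropositionalEquality using (_≡_; refl)
open import Relation.Nullary using (¬_)

module _ {𝓛 : Set} where

  infixl 25 _∖_

  _∖_ : Subset 𝓛 → Subset 𝓛 → Subset 𝓛
  (Γ ∖ Δ) x = Γ x ∧ not (Δ x)

  ∈-∖⁺ : ∀ {Γ Δ : Subset 𝓛} {x} → x ∈ Γ → Δ x ≡ false → x ∈ Γ ∖ Δ
  ∈-∖⁺ {Γ} {Δ} {x} x∈Γ x∉Δ rewrite x∈Γ | x∉Δ = refl

  ∈-∖⁻ : ∀ {Γ Δ : Subset 𝓛} {x} → x ∈ Γ ∖ Δ → x ∈ Γ × Δ x ≡ false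
  ∈-∖⁻ {Γ} {Δ} {x} p with Γ x | Δ x | p
  ... | true | false | _ = refl , refl

  ∖-⊆ : ∀ (Γ Δ : Subset 𝓛) → Γ ∖ Δ ⊆ Γ
  ∖-⊆ Γ Δ x p with ∈-∖⁻ {Γ} {Δ} p
  ... | x∈Γ , _ = x∈Γ

  ∈-∁⁺ : ∀ {Δ : Subset 𝓛} {x} → Δ x ≡ false → x ∈ ∁ Δ
  ∈-∁⁺ {Δ} {x} x∉Δ rewrite x∉Δ = refl

  Monotone : Operator 𝓛 → Set
  Monotone W = ∀ Γ Δ → Γ ⊆ Δ → W Γ ⊆ W Δ

  Inflationary : Operator 𝓛 → Set
  Inflationary W = ∀ Γ → Γ ⊆ W Γ

  NonemptyMeetsImage : Operator 𝓛 → Set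
  NonemptyMeetsImage W = ∀ Γ → CardAtLeast1 Γ → ¬ (Γ ⊆ ∁ (W Γ))

  ∖-image-⊆-∁-image : ∀ {W} → Monotone W → ∀ Γ → (Γ ∖ W Γ) ⊆ ∁ (W (Γ ∖ W Γ))
  ∖-image-⊆-∁-image {W} mono Γ x p with ∈-∖⁻ {Γ} {W Γ} p
  ... | _ , x∉WΓ = ∈-∁⁺ {W (Γ ∖ W Γ)} (¬-not λ x∈WΓ' →
    not-¬ x∉WΓ (mono (Γ ∖ W Γ) Γ (∖-⊆ Γ (W Γ)) x x∈WΓ'))

  inflationary : ∀ {W} → Monotone W → NonemptyMeetsImage W → Inflationary W
  inflationary {W} mono meets Γ x x∈Γ = ¬-not λ x∉WΓ →
    meets (Γ ∖ W Γ) (x , ∈-∖⁺ {Γ} {W Γ} x∈Γ x∉WΓ) (∖-image-⊆-∁-image mono Γ)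

mainTheorem16 : (𝓛 : Set) (W : Operator 𝓛) → ¬ IsR1ConsequenceOperator W
mainTheorem16 𝓛 W ((Γ , Γ⊈WΓ) , _ , meets , mono) = Γ⊈WΓ (inflationary mono meets Γ)
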